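{- Let $c$ be a fixed integer. There is a bound $f(c)$ such that every connected $(P_5,\mathrm{claw})$-free graph $G$ with $\chi(G)\le c$ satisfies $|V(G)|\le f(c)$.
   Context: All graphs are finite, simple and undirected. $P_5$ is the path on 5 vertices and the claw is $K_{1,3}$ (the star with three leaves). A graph is $(H_1,H_2)$-free if it contains no induced subgraph isomorphic to $H_1$ or to $H_2$. $\chi$ denotes the chromatic number. -}

module Defs where

open import Data.Nat using (ℕ; suc)
open import Data.Fin using (Fin; zero; suc)
open import Data.Product using (Σ; _×_; _,_)
open import Data.Empty using (⊥)
open import Data.Unit using (⊤)
open import Relation.Nullary using (¬_)
open import Relation.Binary.PropositionalEquality using (_≡_)
open import Function.Definitions using (Injective)
open import Level using (0ℓ)

record Graph (n : ℕ) : Set₁ where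
  field
    Adj   : Fin n → Fin n → Set
    sym   : ∀ {u v} → Adj u v → Adj v u
    irrefl : ∀ {u} → ¬ Adj u u
open Graph public

record InducedEmbedding {m n : ℕ} (H : Graph m) (G : Graph n) : Set where
  field
    map      : Fin m → Fin n
    injective : Injective _≡_ _≡_ map
    preserve : ∀ u v → Adj H u v → Adj G (map u) (map v)
    reflect  : ∀ u v → Adj G (map u) (map v) → Adj H u v

_≤ᵢ_ : {m n : ℕ} → Graph m → Graph n → Set
H ≤ᵢ G = InducedEmbedding H G

data Walk {n : ℕ} (G : Graph n) : Fin n → Fin n → Set where
  here  : ∀ {u} → Walk G u u
  step  : ∀ {u v w} → Adj G u v → Walk G v w → Walk G u w

Connected : {n : ℕ} → Graph n → Set
Connected {n} G = ∀ (u v : Fin n) → Walk G u v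

ProperColouring : {n : ℕ} → Graph n → (c : ℕ) → (Fin n → Fin c) → Set
ProperColouring {n} G c col = ∀ (u v : Fin n) → Adj G u v → ¬ (col u ≡ col v)

ChromaticAtMost : {n : ℕ} → Graph n → ℕ → Set
ChromaticAtMost {n} G c = Σ (Fin n → Fin c) (ProperColouring G c)

P5-adj : Fin 5 → Fin 5 → Set
P5-adj zero (suc zero) = ⊤
P5-adj (suc zero) zero = ⊤
P5-adj (suc zero) (suc (suc zero)) = ⊤
P5-adj (suc (suc zero)) (suc zero) = ⊤
P5-adj (suc (suc zero)) (suc (suc (suc zero))) = ⊤
P5-adj (suc (suc (suc zero))) (suc (suc zero)) = ⊤
P5-adj (suc (suc (suc zero))) (suc (suc (suc (suc zero)))) = ⊤
P5-adj (suc (suc (suc (suc zero)))) (suc (suc (suc zero))) = ⊤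
P5-adj _ _ = ⊥

P5-sym : ∀ {u v} → P5-adj u v → P5-adj v u
P5-sym {zero} {suc zero} t = t
P5-sym {suc zero} {zero} t = t
P5-sym {suc zero} {suc (suc zero)} t = t
P5-sym {suc (suc zero)} {suc zero} t = t
P5-sym {suc (suc zero)} {suc (suc (suc zero))} t = t
P5-sym {suc (suc (suc zero))} {suc (suc zero)} t = t
P5-sym {suc (suc (suc zero))} {suc (suc (suc (suc zero)))} t = t
P5-sym {suc (suc (suc (suc zero)))} {suc (suc (suc zero))} t = t

P5-irrefl : ∀ {u} → ¬ P5-adj u u
P5-irrefl {zero} ()
P5-irrefl {suc zero} ()
P5-irrefl {suc (suc zero)} ()
P5-irrefl {suc (suc (suc zero))} ()
P5-irrefl {suc (suc (suc (suc zero)))} ()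

P5 : Graph 5
P5 = record { Adj = P5-adj ; sym = P5-sym ; irrefl = P5-irrefl }

Claw-adj : Fin 4 → Fin 4 → Set
Claw-adj zero zero = ⊥
Claw-adj zero (suc _) = ⊤
Claw-adj (suc _) zero = ⊤
Claw-adj (suc _) (suc _) = ⊥

Claw-sym : ∀ {u v} → Claw-adj u v → Claw-adj v u
Claw-sym {zero} {suc _} t = t
Claw-sym {suc _} {zero} t = t

Claw-irrefl : ∀ {u} → ¬ Claw-adj u u
Claw-irrefl {zero} ()
Claw-irrefl {suc _} ()

Claw : Graph 4
Claw = record { Adj = Claw-adj ; sym = Claw-sym ; irrefl = Claw-irrefl }


P5-free : {n : ℕ} → Graph n → Set
P5-free G = ¬ (P5 ≤ᵢ G)

Claw-free : {n : ℕ} → Graph n → Set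
Claw-free G = ¬ (Claw ≤ᵢ G)

-- In a connected P5-free graph every vertex lies within distance 3 of a fixed root r: a vertex at
-- distance exactly 4, together with a shortest path back to r, would induce a P5. In a claw-free
-- graph with a proper c-colouring, a vertex has at most two neighbours of each colour, since three
-- of them would be pairwise non-adjacent and form a claw; so every degree is at most 2c, and the
-- ball of radius 3 around r has at most (1 + 2c)³ vertices.
module Submission where

open import Defs
open import Data.Nat using (ℕ; zero; suc; _+_; _*_; _^_; _≤_; _<_; z≤n; s≤s; _≤?_)
open import Data.Nat.Properties
  using (≤-refl; ≤-trans; ≤-antisym; ≤-pred; ≮⇒≥; suc-injective; +-mono-≤; +-monoʳ-≤; *-monoˡ-≤; *-comm; module ≤-Reasoning)
open import Data.Fin using (Fin; zero; suc; toℕ; inject₁; _≟_)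
open import Data.Fin.Patterns using (0F; 1F; 2F; 3F; 4F)
open import Data.Fin.Properties using (injective⇒≤; toℕ-injective; toℕ-inject₁; <-cmp; any?)
open import Data.Product using (Σ; _×_; _,_; proj₁; proj₂)
open import Data.Sum using (_⊎_; inj₁; inj₂)
open import Data.Empty using (⊥-elim)
open import Data.Unit using (tt)
open import Data.List using (List; []; _∷_; _++_; length; filter; concatMap; allFin; lookup)
open import Data.List.Properties using (length-++; length-tabulate)
open import Data.List.Membership.Propositional using (_∈_; lose)
open import Data.List.Membership.Propositional.Properties using (∈-++⁺ˡ; ∈-++⁺ʳ; ∈-concatMap⁺; ∈-filter⁺; ∈-allFin)
open import Data.List.Relation.Unary.Any using (here; index)
open import Data.List.Relation.Unary.Any.Properties using (lookup-index)
open import Data.List.Relation.Unary.All using (All; []; _∷_)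
open import Data.List.Relation.Unary.All.Properties using (all-filter)
open import Data.List.Relation.Unary.AllPairs using (_∷_)
open import Data.List.Relation.Unary.Unique.Propositional using (Unique)
open import Data.List.Relation.Unary.Unique.Propositional.Properties using (filter⁺; allFin⁺)
open import Data.Vec using (Vec; []; _∷_)
import Data.Vec as Vec
open import Data.Vec.Relation.Unary.All.Properties using (lookup⁺)
open import Data.Vec.Relation.Unary.All using ([]; _∷_)
open import Data.Vec.Relation.Unary.AllPairs using ([]; _∷_)
open import Data.Vec.Relation.Unary.Unique.Propositional.Properties using (lookup-injective)
open import Function using (_∘_)
open import Function.Definitions using (Injective)
open import Relation.Binary using (tri<; tri≈; tri>)
open import Relation.Nullary using (¬_; Dec; yes; no)
open import Relation.Nullary.Decidable using (_×-dec_; _⊎-dec_; decidable-stable; ¬¬-excluded-middle)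
open import Relation.Binary.PropositionalEquality using (_≡_; _≢_; refl; trans; cong; subst)
import Relation.Binary.PropositionalEquality as ≡

covering-length : ∀ {n} (xs : List (Fin n)) → (∀ i → i ∈ xs) → n ≤ length xs
covering-length xs ∈xs = injective⇒≤ index-injective
  where
  index-injective : ∀ {i j} → index (∈xs i) ≡ index (∈xs j) → i ≡ j
  index-injective {i} {j} eq =
    trans (lookup-index (∈xs i)) (trans (cong (lookup xs) eq) (≡.sym (lookup-index (∈xs j))))

length-concatMap-≤ : ∀ {A B : Set} (f : A → List B) {m} → (∀ x → length (f x) ≤ m) →
                     ∀ xs → length (concatMap f xs) ≤ length xs * m
length-concatMap-≤ f f≤ [] = z≤n
length-concatMap-≤ f f≤ (x ∷ xs) =
  subst (_≤ _) (≡.sym (length-++ (f x))) (+-mono-≤ (f≤ x) (length-concatMap-≤ f f≤ xs))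

¬¬-∀-Fin : ∀ {n} {P : Fin n → Set} → (∀ i → ¬ ¬ P i) → ¬ ¬ (∀ i → P i)
¬¬-∀-Fin {zero}  _ k = k λ ()
¬¬-∀-Fin {suc n} h k = h zero λ p₀ → ¬¬-∀-Fin (h ∘ suc) λ ps → k λ { zero → p₀ ; (suc i) → ps i }

P5-consecutive : ∀ i j → toℕ j ≡ suc (toℕ i) → P5-adj i j
P5-consecutive i zero ()
P5-consecutive i (suc j) eq =
  subst (λ i → P5-adj i (suc j)) (toℕ-injective (trans (toℕ-inject₁ j) (suc-injective eq))) (edge j)
  where
  edge : ∀ j → P5-adj (inject₁ j) (suc j)
  edge 0F = tt
  edge 1F = tt
  edge 2F = tt
  edge 3F = tt

module _ {n} (G : Graph n) where

  with-decidable-Adj : ∀ {P : Set} → Dec P → ((∀ u v → Dec (Adj G u v)) → P) → P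
  with-decidable-Adj P? k =
    decidable-stable P? λ ¬p → ¬¬-∀-Fin (λ u → ¬¬-∀-Fin λ v → ¬¬-excluded-middle) (¬p ∘ k)

  star⇒Claw : (v : Fin n) (ℓ : Fin 3 → Fin n) → Injective _≡_ _≡_ ℓ →
              (∀ i → Adj G v (ℓ i)) → (∀ i j → ¬ Adj G (ℓ i) (ℓ j)) → Claw ≤ᵢ G
  star⇒Claw v ℓ ℓ-injective spoke independent =
    record { map = f ; injective = f-injective ; preserve = preserve ; reflect = reflect }
    where
    f : Fin 4 → Fin n
    f zero    = v
    f (suc i) = ℓ i

    centre≢leaf : ∀ i → v ≢ ℓ i
    centre≢leaf i v≡ℓi = irrefl G (subst (Adj G v) (≡.sym v≡ℓi) (spoke i))

    f-injective : Injective _≡_ _≡_ f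
    f-injective {zero}  {zero}  _  = refl
    f-injective {zero}  {suc j} eq = ⊥-elim (centre≢leaf j eq)
    f-injective {suc i} {zero}  eq = ⊥-elim (centre≢leaf i (≡.sym eq))
    f-injective {suc i} {suc j} eq = cong suc (ℓ-injective eq)

    preserve : ∀ i j → Adj Claw i j → Adj G (f i) (f j)
    preserve zero    (suc j) _ = spoke j
    preserve (suc i) zero    _ = sym G (spoke i)

    reflect : ∀ i j → Adj G (f i) (f j) → Adj Claw i j
    reflect zero    zero    a = ⊥-elim (irrefl G a)
    reflect zero    (suc _) _ = tt
    reflect (suc _) zero    _ = tt
    reflect (suc i) (suc j) a = ⊥-elim (independent i j a)

  module Colouring {c} {col : Fin n → Fin c} (proper : ProperColouring G c col)
                   (claw-free : Claw-free G) where

    NeighbourOfColour : Fin n → Fin c → Fin n → Set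
    NeighbourOfColour v k u = Adj G v u × col u ≡ k

    same-colour-neighbours-≤2 : ∀ {v k} {S : List (Fin n)} → Unique S →
                                All (NeighbourOfColour v k) S → length S ≤ 2
    same-colour-neighbours-≤2 _ [] = z≤n
    same-colour-neighbours-≤2 _ (_ ∷ []) = s≤s z≤n
    same-colour-neighbours-≤2 _ (_ ∷ _ ∷ []) = ≤-refl
    same-colour-neighbours-≤2 {v} {k} {a ∷ b ∷ d ∷ _}
      ((a≢b ∷ a≢d ∷ _) ∷ (b≢d ∷ _) ∷ _) (pa ∷ pb ∷ pd ∷ _) =
      ⊥-elim (claw-free (star⇒Claw v ℓ ℓ-injective (proj₁ ∘ leaf) independent))
      where
      leaves : Vec (Fin n) 3
      leaves = a ∷ b ∷ d ∷ []
      ℓ : Fin 3 → Fin n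
      ℓ = Vec.lookup leaves
      ℓ-injective : Injective _≡_ _≡_ ℓ
      ℓ-injective = lookup-injective ((a≢b ∷ a≢d ∷ []) ∷ (b≢d ∷ []) ∷ [] ∷ []) _ _
      leaf : ∀ i → NeighbourOfColour v k (ℓ i)
      leaf i = lookup⁺ {P = NeighbourOfColour v k} {xs = leaves} (pa ∷ pb ∷ pd ∷ []) i
      independent : ∀ i j → ¬ Adj G (ℓ i) (ℓ j)
      independent i j a = proper _ _ a (trans (proj₂ (leaf i)) (≡.sym (proj₂ (leaf j))))

    module _ (Adj? : ∀ u v → Dec (Adj G u v)) where

      neighbours-of-colour : Fin n → Fin c → List (Fin n)
      neighbours-of-colour v k = filter (λ u → Adj? v u ×-dec (col u ≟ k)) (allFin n)

      neighbours : Fin n → List (Fin n)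
      neighbours v = concatMap (neighbours-of-colour v) (allFin c)

      Adj⇒∈neighbours : ∀ {v u} → Adj G v u → u ∈ neighbours v
      Adj⇒∈neighbours {v} {u} a =
        ∈-concatMap⁺ (neighbours-of-colour v)
          (lose (∈-allFin (col u)) (∈-filter⁺ _ (∈-allFin u) (a , refl)))

      length-neighbours : ∀ v → length (neighbours v) ≤ c * 2
      length-neighbours v = subst (λ m → length (neighbours v) ≤ m * 2) (length-tabulate {n = c} _)
        (length-concatMap-≤ (neighbours-of-colour v) length-of-colour (allFin c))
        where
        length-of-colour : ∀ k → length (neighbours-of-colour v k) ≤ 2
        length-of-colour k = same-colour-neighbours-≤2 (filter⁺ _ (allFin⁺ n)) (all-filter _ (allFin n))

  module Balls (r : Fin n) where

    Ball : ℕ → Fin n → Set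
    Ball zero    u = u ≡ r
    Ball (suc k) u = Ball k u ⊎ Σ (Fin n) λ v → Ball k v × Adj G v u

    Ball-mono : ∀ {j k u} → j ≤ k → Ball j u → Ball k u
    Ball-mono {k = zero}  z≤n b = b
    Ball-mono {k = suc k} z≤n b = inj₁ (Ball-mono z≤n b)
    Ball-mono (s≤s j≤k) (inj₁ b)           = inj₁ (Ball-mono j≤k b)
    Ball-mono (s≤s j≤k) (inj₂ (v , b , a)) = inj₂ (v , Ball-mono j≤k b , a)

    Sphere : ℕ → Fin n → Set
    Sphere k u = Ball k u × (∀ {j} → j < k → ¬ Ball j u)

    Sphere-pred : ∀ {k v} → Sphere (suc k) v → Σ (Fin n) λ u → Sphere k u × Adj G u v
    Sphere-pred (inj₁ b , outside) = ⊥-elim (outside ≤-refl b)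
    Sphere-pred (inj₂ (u , b , a) , outside) =
      u , (b , λ j<k bj → outside (s≤s j<k) (inj₂ (u , bj , a))) , a

    module _ {m} (x : Fin m → Fin n) (layer : ∀ i → Sphere (toℕ i) (x i)) where

      layers-injective : Injective _≡_ _≡_ x
      layers-injective {i} {j} eq with <-cmp i j
      ... | tri< i<j _ _ = ⊥-elim (proj₂ (layer j) i<j (subst (Ball (toℕ i)) eq (proj₁ (layer i))))
      ... | tri≈ _ i≡j _ = i≡j
      ... | tri> _ _ j<i = ⊥-elim (proj₂ (layer i) j<i (subst (Ball (toℕ j)) (≡.sym eq) (proj₁ (layer j))))

      layers-adjacent : ∀ i j → Adj G (x i) (x j) → toℕ i < toℕ j → toℕ j ≡ suc (toℕ i)
      layers-adjacent i j a i<j =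
        ≤-antisym (≮⇒≥ λ far → proj₂ (layer j) far (inj₂ (x i , proj₁ (layer i) , a))) i<j

    geodesic⇒P5 : (x : Fin 5 → Fin n) → (∀ i → Sphere (toℕ i) (x i)) →
                  (∀ i j → P5-adj i j → Adj G (x i) (x j)) → P5 ≤ᵢ G
    geodesic⇒P5 x layer path =
      record { map = x ; injective = layers-injective x layer ; preserve = path ; reflect = reflect }
      where
      reflect : ∀ i j → Adj G (x i) (x j) → P5-adj i j
      reflect i j a with <-cmp i j
      ... | tri< i<j _ _  = P5-consecutive i j (layers-adjacent x layer i j a i<j)
      ... | tri≈ _ refl _ = ⊥-elim (irrefl G a)
      ... | tri> _ _ j<i  = P5-sym (P5-consecutive j i (layers-adjacent x layer j i (sym G a) j<i))

    P5-free⇒Sphere₄-empty : P5-free G → ∀ {u} → ¬ Sphere 4 u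
    P5-free⇒Sphere₄-empty p5-free {x₄} s₄ with Sphere-pred s₄
    ... | x₃ , s₃ , a₃₄ with Sphere-pred s₃
    ... | x₂ , s₂ , a₂₃ with Sphere-pred s₂
    ... | x₁ , s₁ , a₁₂ with Sphere-pred s₁
    ... | x₀ , s₀ , a₀₁ = p5-free (geodesic⇒P5 x layer path)
      where
      x : Fin 5 → Fin n
      x 0F = x₀
      x 1F = x₁
      x 2F = x₂
      x 3F = x₃
      x 4F = x₄

      layer : ∀ i → Sphere (toℕ i) (x i)
      layer 0F = s₀
      layer 1F = s₁
      layer 2F = s₂
      layer 3F = s₃
      layer 4F = s₄

      path : ∀ i j → P5-adj i j → Adj G (x i) (x j)
      path 0F 1F _ = a₀₁
      path 1F 0F _ = sym G a₀₁
      path 1F 2F _ = a₁₂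
      path 2F 1F _ = sym G a₁₂
      path 2F 3F _ = a₂₃
      path 3F 2F _ = sym G a₂₃
      path 3F 4F _ = a₃₄
      path 4F 3F _ = sym G a₃₄

    module _ (Adj? : ∀ u v → Dec (Adj G u v)) where

      Ball? : ∀ k u → Dec (Ball k u)
      Ball? zero    u = u ≟ r
      Ball? (suc k) u = Ball? k u ⊎-dec any? λ v → Ball? k v ×-dec Adj? v u

      P5-free⇒Ball₃-closed : P5-free G → ∀ {u v} → Adj G u v → Ball 3 u → Ball 3 v
      P5-free⇒Ball₃-closed p5-free {u} {v} a b with Ball? 3 v
      ... | yes b′ = b′
      ... | no  ¬b′ =
        ⊥-elim (P5-free⇒Sphere₄-empty p5-free (inj₂ (u , b , a) , λ j<4 → ¬b′ ∘ Ball-mono (≤-pred j<4)))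

      Walk⇒Ball₃ : P5-free G → ∀ {u} → Walk G u r → Ball 3 u
      Walk⇒Ball₃ p5-free here         = Ball-mono z≤n refl
      Walk⇒Ball₃ p5-free (step a walk) =
        P5-free⇒Ball₃-closed p5-free (sym G a) (Walk⇒Ball₃ p5-free walk)

    module _ (N : Fin n → List (Fin n)) (Adj⇒∈N : ∀ {u v} → Adj G u v → v ∈ N u)
             {Δ} (length-N : ∀ u → length (N u) ≤ Δ) where

      ball : ℕ → List (Fin n)
      ball zero    = r ∷ []
      ball (suc k) = ball k ++ concatMap N (ball k)

      Ball⇒∈ball : ∀ k {u} → Ball k u → u ∈ ball k
      Ball⇒∈ball zero    u≡r                = here u≡r
      Ball⇒∈ball (suc k) (inj₁ b)           = ∈-++⁺ˡ (Ball⇒∈ball k b)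
      Ball⇒∈ball (suc k) (inj₂ (v , b , a)) =
        ∈-++⁺ʳ (ball k) (∈-concatMap⁺ N (lose (Ball⇒∈ball k b) (Adj⇒∈N a)))

      length-ball : ∀ k → length (ball k) ≤ (1 + Δ) ^ k
      length-ball zero    = ≤-refl
      length-ball (suc k) = begin
        length (ball k ++ concatMap N (ball k))         ≡⟨ length-++ (ball k) ⟩
        length (ball k) + length (concatMap N (ball k)) ≤⟨ +-monoʳ-≤ _ (length-concatMap-≤ N length-N (ball k)) ⟩
        length (ball k) + length (ball k) * Δ           ≤⟨ +-mono-≤ ih (*-monoˡ-≤ Δ ih) ⟩
        (1 + Δ) ^ k + (1 + Δ) ^ k * Δ                   ≡⟨ cong ((1 + Δ) ^ k +_) (*-comm ((1 + Δ) ^ k) Δ) ⟩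
        (1 + Δ) ^ suc k                                 ∎
        where
        open ≤-Reasoning
        ih : length (ball k) ≤ (1 + Δ) ^ k
        ih = length-ball k

      Ball-covering⇒≤ : ∀ k → (∀ u → Ball k u) → n ≤ (1 + Δ) ^ k
      Ball-covering⇒≤ k covers =
        ≤-trans (covering-length (ball k) (λ u → Ball⇒∈ball k (covers u))) (length-ball k)

lemma5 : (c : ℕ) → Σ ℕ (λ f → ∀ (n : ℕ) (G : Graph n) → Connected G → P5-free G → Claw-free G → ChromaticAtMost G c → n ≤ f)
lemma5 c = (1 + c * 2) ^ 3 , bound
  where
  bound : ∀ n (G : Graph n) → Connected G → P5-free G → Claw-free G → ChromaticAtMost G c → n ≤ (1 + c * 2) ^ 3
  bound zero    _ _ _ _ _ = z≤n
  bound (suc n) G connected p5-free claw-free (col , proper) =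
    with-decidable-Adj G (suc n ≤? _) λ Adj? →
      let open Balls G 0F
          open Colouring G proper claw-free
      in Ball-covering⇒≤ (neighbours Adj?) (Adj⇒∈neighbours Adj?) (length-neighbours Adj?) 3
           λ u → Walk⇒Ball₃ Adj? p5-free (connected u 0F)
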